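{- Let $G$ be a graph, let $k\ge 3$ be an integer, and let $S\subseteq E(G)$ with $|S|\ge 2$. Let $\ell=\min\{d_G(e,f): e,f\in S,\ e\ne f\}$ and $L=\max\{d_G(e,f): e,f\in S\}$. If $L<\ell(k-1)+(k-2)$, then $S$ is an edge $k$-general position set of $G$.
   Context: For edges $e,f$, $d_G(e,f)$ is the minimum distance between an end-vertex of $e$ and an end-vertex of $f$. A geodesic is a shortest path. An edge $k$-general position set of $G$ is a set $S\subseteq E(G)$ such that $|S\cap E(P)|\le k-1$ for every geodesic $P$ of $G$. -}

module Defs where

open import Level using (0ℓ)
open import Data.Nat using (ℕ; zero; suc; _≤_; _<_)
open import Data.Fin using (Fin; toℕ)
open import Data.Fin.Properties using () renaming (_≟_ to _≟ᶠ_)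
open import Data.Product using (Σ; ∃; _×_; _,_; proj₁; proj₂)
open import Data.Product.Properties using (≡-dec)
open import Data.Sum using (_⊎_)
open import Data.List using (List; []; _∷_; length; filter)
open import Data.List.Membership.Propositional using (_∈_)
import Data.List.Membership.DecPropositional as DecMem
open import Relation.Nullary using (¬_; Dec)
open import Relation.Nullary.Decidable using (_⊎-dec_)
open import Relation.Binary.PropositionalEquality using (_≡_)

record Graph (n : ℕ) : Set₁ where
  field
    Adj        : Fin n → Fin n → Set
    Adj-sym    : ∀ {u v} → Adj u v → Adj v u
    Adj-irrefl : ∀ {u} → ¬ Adj u u
open Graph public

module _ {n : ℕ} (G : Graph n) where

  open DecMem (≡-dec (_≟ᶠ_ {n}) (_≟ᶠ_ {n})) using (_∈?_)

  data Walk : Fin n → Fin n → ℕ → Set where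
    []  : ∀ {u} → Walk u u zero
    _∷_ : ∀ {u w v m} → Adj G u w → Walk w v m → Walk u v (suc m)

  Connected : Set
  Connected = ∀ u v → ∃ λ m → Walk u v m

  Dist : Fin n → Fin n → ℕ → Set
  Dist u v d = Walk u v d × (∀ m → Walk u v m → d ≤ m)

  IsGeodesic : ∀ {u v m} → Walk u v m → Set
  IsGeodesic {u} {v} {m} _ = Dist u v m

  -- Edges are represented as pairs (a , b) with toℕ a < toℕ b and a ~ b.
  IsEdge : Fin n × Fin n → Set
  IsEdge (a , b) = (toℕ a < toℕ b) × Adj G a b

  steps : ∀ {u v m} → Walk u v m → List (Fin n × Fin n)
  steps [] = []
  steps (_∷_ {u} {w} _ p) = (u , w) ∷ steps p

  OnWalk : ∀ {u v m} → Walk u v m → Fin n × Fin n → Set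
  OnWalk P (a , b) = ((a , b) ∈ steps P) ⊎ ((b , a) ∈ steps P)

  onWalk? : ∀ {u v m} (P : Walk u v m) (e : Fin n × Fin n) → Dec (OnWalk P e)
  onWalk? P (a , b) = ((a , b) ∈? steps P) ⊎-dec ((b , a) ∈? steps P)

  countOn : ∀ {u v m} → Walk u v m → List (Fin n × Fin n) → ℕ
  countOn P S = length (filter (onWalk? P) S)

  Ends : Fin n × Fin n → Fin n → Set
  Ends (a , b) x = (x ≡ a) ⊎ (x ≡ b)

  EdgeDist : Fin n × Fin n → Fin n × Fin n → ℕ → Set
  EdgeDist e f d =
    (∃ λ x → ∃ λ y → Ends e x × Ends f y × Dist x y d) ×
    (∀ x y d' → Ends e x → Ends f y → Dist x y d' → d ≤ d')

  EdgeGeneralPosition : ℕ → List (Fin n × Fin n) → Set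
  EdgeGeneralPosition k S =
    ∀ u v m (P : Walk u v m) → IsGeodesic P → countOn P S Data.Nat.≤ k Data.Nat.∸ 1

-- Consecutive vertices of a geodesic P are at distance given by their index difference, so
-- two edges of S traversed by P as its p-th and q-th steps (p < q) are at edge distance
-- q - p - 1. Hence the step indices of the c edges of S on P are pairwise between ℓ + 1
-- and L + 1 apart; sorted, they force (c - 1)(ℓ + 1) ≤ L + 1, and L < ℓ(k - 1) + (k - 2)
-- then leaves c ≤ k - 1.
module Submission where

open import Defs
open import Data.Nat
open import Data.Nat.Properties
open import Data.Nat.Tactic.RingSolver using (solve-∀)
open import Data.Fin using (Fin)
open import Data.Empty using (⊥-elim)
open import Data.Product using (∃; _×_; _,_; proj₁; proj₂)
open import Data.Sum using (inj₁; inj₂)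
open import Data.List using (List; []; _∷_; length; filter)
open import Data.List.Relation.Unary.Any using (here; there)
open import Data.List.Relation.Unary.All as All using (All; []; _∷_)
open import Data.List.Relation.Unary.AllPairs as AllPairs using (AllPairs; []; _∷_)
open import Data.List.Relation.Unary.Linked using (Linked; _∷_)
open import Data.List.Relation.Unary.Unique.Propositional using (Unique)
import Data.List.Relation.Unary.Unique.Propositional.Properties as Unique
open import Data.List.Membership.Propositional using (_∈_)
open import Data.List.Membership.Propositional.Properties using (∈-filter⁻)
open import Data.List.Relation.Binary.Permutation.Propositional using (↭-sym; ↭⇒↭ₛ)
open import Data.List.Relation.Binary.Permutation.Propositional.Properties using (↭-length)
open import Data.List.Sort ≤-decTotalOrder using (sort; sort-↭; sort-↗)
open import Relation.Nullary using (¬_; yes; no)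
open import Relation.Binary using (tri<; tri≈; tri>)
open import Relation.Binary.PropositionalEquality
open import Data.List.Relation.Binary.Permutation.Setoid.Properties (setoid ℕ)
  using (AllPairs-resp-↭)

Within : ℕ → ℕ → ℕ → ℕ → Set
Within g D a b = g ≤ ∣ a - b ∣ × ∣ a - b ∣ ≤ D

within-sym : ∀ {g D a b} → Within g D a b → Within g D b a
within-sym {a = a} {b} = subst (λ d → _ ≤ d × d ≤ _) (∣-∣-comm a b)

m≤n∧o≤∣m-n∣⇒m+o≤n : ∀ {g x y} → x ≤ y → g ≤ ∣ x - y ∣ → x + g ≤ y
m≤n∧o≤∣m-n∣⇒m+o≤n {g} {x} {y} x≤y g≤∣x-y∣ = subst (_≤ y) (+-comm g x)
  (m≤o∸n⇒m+n≤o g x≤y (subst (g ≤_) (m≤n⇒∣m-n∣≡n∸m x≤y) g≤∣x-y∣))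

sorted-spread : ∀ {g H x xs} → Linked _≤_ (x ∷ xs) → AllPairs (λ a b → g ≤ ∣ a - b ∣) (x ∷ xs) →
  All (_≤ H) (x ∷ xs) → x + length xs * g ≤ H
sorted-spread {x = x} {[]} _ _ (x≤H ∷ []) = subst (_≤ _) (sym (+-identityʳ x)) x≤H
sorted-spread {g} {x = x} {y ∷ ys} (x≤y ∷ sorted) ((xy ∷ _) ∷ within) (_ ∷ bounded) = begin
  x + (g + length ys * g) ≡⟨ +-assoc x g _ ⟨
  x + g + length ys * g   ≤⟨ +-monoˡ-≤ _ (m≤n∧o≤∣m-n∣⇒m+o≤n x≤y xy) ⟩
  y + length ys * g       ≤⟨ sorted-spread sorted within bounded ⟩
  _                       ∎
  where open ≤-Reasoning

sorted-packing : ∀ {g D} xs → Linked _≤_ xs → AllPairs (Within g D) xs → (length xs ∸ 1) * g ≤ D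
sorted-packing [] _ _ = z≤n
sorted-packing (x ∷ xs) sorted within@(x-within ∷ _) = +-cancelˡ-≤ x _ _
  (sorted-spread sorted (AllPairs.map proj₁ within) (m≤m+n x _ ∷ All.map bounded x-within))
  where
  bounded : ∀ {y} → Within _ _ x y → y ≤ x + _
  bounded {y} xy = ≤-trans (m≤n+∣n-m∣ y x) (+-monoʳ-≤ x (proj₂ xy))

packing : ∀ {g D} xs → AllPairs (Within g D) xs → (length xs ∸ 1) * g ≤ D
packing {g} {D} xs within = subst (λ c → (c ∸ 1) * g ≤ D) (↭-length (sort-↭ xs))
  (sorted-packing (sort xs) (sort-↗ xs)
    (AllPairs-resp-↭ (λ {a b} → within-sym {g} {D} {a} {b}) (resp₂ (Within g D))
      (↭⇒↭ₛ (↭-sym (sort-↭ xs))) within))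

module _ {A B : Set} {P : A → Set} (f : ∀ {x} → P x → B) where

  length-reduce : ∀ {xs} (pxs : All P xs) → length (All.reduce f pxs) ≡ length xs
  length-reduce []        = refl
  length-reduce (_ ∷ pxs) = cong suc (length-reduce pxs)

  All-reduce : ∀ {Q : A → Set} {T : B → Set} → (∀ {x} (px : P x) → Q x → T (f px)) →
    ∀ {xs} (pxs : All P xs) → All Q xs → All T (All.reduce f pxs)
  All-reduce g []         []         = []
  All-reduce g (px ∷ pxs) (qx ∷ qxs) = g px qx ∷ All-reduce g pxs qxs

  AllPairs-reduce : ∀ {R : A → A → Set} {T : B → B → Set} →
    (∀ {x y} (px : P x) (py : P y) → R x y → T (f px) (f py)) →
    ∀ {xs} (pxs : All P xs) → AllPairs R xs → AllPairs T (All.reduce f pxs)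
  AllPairs-reduce g []         []         = []
  AllPairs-reduce g (px ∷ pxs) (rx ∷ rxs) = All-reduce (g px) pxs rx ∷ AllPairs-reduce g pxs rxs

module _ {n : ℕ} (G : Graph n) where

  vertex : ∀ {u v m} → Walk G u v m → ℕ → Fin n
  vertex {u} _       zero    = u
  vertex {u} []      (suc i) = u
  vertex     (_ ∷ p) (suc i) = vertex p i

  take : ∀ {u v m} (P : Walk G u v m) i → i ≤ m → Walk G u (vertex P i) i
  take P       zero    _         = []
  take (a ∷ p) (suc i) (s≤s i≤m) = a ∷ take p i i≤m

  drop : ∀ {u v m} (P : Walk G u v m) i → Walk G (vertex P i) v (m ∸ i)
  drop P       zero    = P
  drop []      (suc i) = []
  drop (a ∷ p) (suc i) = drop p i

  _++_ : ∀ {u w v a b} → Walk G u w a → Walk G w v b → Walk G u v (a + b)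
  []      ++ q = q
  (a ∷ p) ++ q = a ∷ (p ++ q)

  vertex-drop : ∀ {u v m} (P : Walk G u v m) i j → vertex (drop P i) j ≡ vertex P (i + j)
  vertex-drop P       zero    j       = refl
  vertex-drop []      (suc i) zero    = refl
  vertex-drop []      (suc i) (suc j) = refl
  vertex-drop (a ∷ p) (suc i) j       = vertex-drop p i j

  segment : ∀ {u v m} (P : Walk G u v m) {i j} → i ≤ j → j ≤ m →
    Walk G (vertex P i) (vertex P j) (j ∸ i)
  segment P {i} {j} i≤j j≤m =
    subst (λ y → Walk G (vertex P i) y (j ∸ i)) vertex-j
      (take (drop P i) (j ∸ i) (∸-monoˡ-≤ i j≤m))
    where
    vertex-j : vertex (drop P i) (j ∸ i) ≡ vertex P j
    vertex-j = trans (vertex-drop P i (j ∸ i)) (cong (vertex P) (m+[n∸m]≡n i≤j))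

  module _ {u v m} {P : Walk G u v m} (geodesic : IsGeodesic G P) where

    -- A shorter walk between two vertices of P could be spliced into P.
    segment-shortest : ∀ {i j d} → i ≤ j → j ≤ m → Walk G (vertex P i) (vertex P j) d → j ∸ i ≤ d
    segment-shortest {i} {j} {d} i≤j j≤m w =
      m≤n+o⇒m∸n≤o j i (+-cancelʳ-≤ (m ∸ j) j (i + d) spliced)
      where
      spliced : j + (m ∸ j) ≤ i + d + (m ∸ j)
      spliced = subst₂ _≤_ (sym (m+[n∸m]≡n j≤m)) (sym (+-assoc i d (m ∸ j)))
        (proj₂ geodesic _ (take P i (≤-trans i≤j j≤m) ++ (w ++ drop P j)))

    segment-dist : ∀ {i j} → i ≤ j → j ≤ m → Dist G (vertex P i) (vertex P j) (j ∸ i)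
    segment-dist i≤j j≤m = segment P i≤j j≤m , λ _ → segment-shortest i≤j j≤m

  ∈-steps⇒step : ∀ {u v m} (P : Walk G u v m) {a b} → (a , b) ∈ steps G P →
    ∃ λ p → p < m × a ≡ vertex P p × b ≡ vertex P (suc p)
  ∈-steps⇒step (_ ∷ _) (here refl) = 0 , s≤s z≤n , refl , refl
  ∈-steps⇒step (_ ∷ p) (there h) with ∈-steps⇒step p h
  ... | q , q<m , refl , refl = suc q , s≤s q<m , refl , refl

  data StepAt {u v m} (P : Walk G u v m) : Fin n × Fin n → ℕ → Set where
    forward  : ∀ p → StepAt P (vertex P p , vertex P (suc p)) p
    backward : ∀ p → StepAt P (vertex P (suc p) , vertex P p) p

  module _ {u v m} {P : Walk G u v m} where

    onWalk⇒stepAt : ∀ {e} → OnWalk G P e → ∃ λ p → p < m × StepAt P e p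
    onWalk⇒stepAt (inj₁ ab∈P) with ∈-steps⇒step P ab∈P
    ... | p , p<m , refl , refl = p , p<m , forward p
    onWalk⇒stepAt (inj₂ ba∈P) with ∈-steps⇒step P ba∈P
    ... | p , p<m , refl , refl = p , p<m , backward p

    stepAt-ends : ∀ {e p} → StepAt P e p → Ends G e (vertex P p) × Ends G e (vertex P (suc p))
    stepAt-ends (forward _)  = inj₁ refl , inj₂ refl
    stepAt-ends (backward _) = inj₂ refl , inj₁ refl

    stepAt-ends⁻ : ∀ {e p x} → StepAt P e p → Ends G e x →
      ∃ λ i → x ≡ vertex P i × p ≤ i × i ≤ suc p
    stepAt-ends⁻ (forward p)  (inj₁ refl) = p , refl , ≤-refl , n≤1+n p
    stepAt-ends⁻ (forward p)  (inj₂ refl) = suc p , refl , n≤1+n p , ≤-refl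
    stepAt-ends⁻ (backward p) (inj₁ refl) = suc p , refl , n≤1+n p , ≤-refl
    stepAt-ends⁻ (backward p) (inj₂ refl) = p , refl , ≤-refl , n≤1+n p

    -- Edges are stored with their smaller end first, so an edge has one orientation only.
    stepAt-injective : ∀ {e f p} → IsEdge G e → IsEdge G f → StepAt P e p → StepAt P f p → e ≡ f
    stepAt-injective _        _        (forward _)  (forward _)  = refl
    stepAt-injective _        _        (backward _) (backward _) = refl
    stepAt-injective (e< , _) (f< , _) (forward _)  (backward _) = ⊥-elim (<-asym e< f<)
    stepAt-injective (e< , _) (f< , _) (backward _) (forward _)  = ⊥-elim (<-asym e< f<)

    edgeDist-stepAt : IsGeodesic G P → ∀ {e f p q} → StepAt P e p → StepAt P f q → p < q → q < m →
      EdgeDist G e f (q ∸ suc p)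
    edgeDist-stepAt geodesic {e} {f} {p} {q} e-at f-at p<q q<m =
      (vertex P (suc p) , vertex P q , proj₂ (stepAt-ends e-at) , proj₁ (stepAt-ends f-at) ,
        segment-dist geodesic p<q (<⇒≤ q<m)) ,
      minimal
      where
      minimal : ∀ x y d → Ends G e x → Ends G f y → Dist G x y d → q ∸ suc p ≤ d
      minimal x y d ex fy (w , _) with stepAt-ends⁻ e-at ex | stepAt-ends⁻ f-at fy
      ... | i , refl , _ , i≤1+p | j , refl , q≤j , j≤1+q =
        ≤-trans (∸-mono q≤j i≤1+p)
          (segment-shortest geodesic (≤-trans i≤1+p (≤-trans p<q q≤j)) (≤-trans j≤1+q q<m) w)

m<n⇒∣m-n∣≡suc[n∸suc[m]] : ∀ {m n} → m < n → ∣ m - n ∣ ≡ suc (n ∸ suc m)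
m<n⇒∣m-n∣≡suc[n∸suc[m]] m<n = trans (m≤n⇒∣m-n∣≡n∸m (<⇒≤ m<n)) (+-∸-assoc 1 m<n)

module _ {n} {G : Graph n} {S : List (Fin n × Fin n)} {ℓ L : ℕ}
  (ℓ-min : ∀ e f d → e ∈ S → f ∈ S → ¬ e ≡ f → EdgeDist G e f d → ℓ ≤ d)
  (L-max : ∀ e f d → e ∈ S → f ∈ S → EdgeDist G e f d → d ≤ L)
  {u v m} {P : Walk G u v m} (geodesic : IsGeodesic G P) where

  Occurs : Fin n × Fin n → Set
  Occurs e = e ∈ S × IsEdge G e × ∃ λ p → p < m × StepAt G P e p

  position : ∀ {e} → Occurs e → ℕ
  position (_ , _ , p , _) = p

  positions-within-< : ∀ {e f p q} → e ∈ S → f ∈ S → ¬ e ≡ f →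
    StepAt G P e p → StepAt G P f q → p < q → q < m → Within (suc ℓ) (suc L) p q
  positions-within-< e∈S f∈S e≢f e-at f-at p<q q<m =
    subst (λ d → suc ℓ ≤ d × d ≤ suc L) (sym (m<n⇒∣m-n∣≡suc[n∸suc[m]] p<q))
      (s≤s (ℓ-min _ _ _ e∈S f∈S e≢f dist) , s≤s (L-max _ _ _ e∈S f∈S dist))
    where dist = edgeDist-stepAt G geodesic e-at f-at p<q q<m

  positions-within : ∀ {e f} (oe : Occurs e) (of : Occurs f) → ¬ e ≡ f →
    Within (suc ℓ) (suc L) (position oe) (position of)
  positions-within (e∈S , e-edge , p , p<m , e-at) (f∈S , f-edge , q , q<m , f-at) e≢f
    with <-cmp p q
  ... | tri< p<q _ _ = positions-within-< e∈S f∈S e≢f e-at f-at p<q q<m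
  ... | tri≈ _ refl _ = ⊥-elim (e≢f (stepAt-injective G e-edge f-edge e-at f-at))
  ... | tri> _ _ q<p = within-sym {a = q} {b = p}
    (positions-within-< f∈S e∈S (λ f≡e → e≢f (sym f≡e)) f-at e-at q<p p<m)

  countOn-bound : All (IsEdge G) S → Unique S → (countOn G P S ∸ 1) * suc ℓ ≤ suc L
  countOn-bound edges unique =
    subst (λ c → (c ∸ 1) * suc ℓ ≤ suc L) (length-reduce position occurrences)
      (packing _ (AllPairs-reduce position positions-within occurrences
        (Unique.filter⁺ (onWalk? G P) unique)))
    where
    occurrences : All Occurs (filter (onWalk? G P) S)
    occurrences = All.tabulate λ e∈F →
      let e∈S , on-P = ∈-filter⁻ (onWalk? G P) {xs = S} e∈F
      in e∈S , All.lookup edges e∈S , onWalk⇒stepAt G on-P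

packed-count-≤ : ∀ {c ℓ L} k → 2 ≤ k → (c ∸ 1) * suc ℓ ≤ suc L → L < ℓ * (k ∸ 1) + (k ∸ 2) → c ≤ k ∸ 1
packed-count-≤ {c} {ℓ} {L} (suc (suc i)) (s≤s (s≤s z≤n)) packed L< with c ≤? suc i
... | yes c≤ = c≤
... | no c≰ = ⊥-elim (1+n≰n (begin
  suc (suc L)             ≤⟨ s≤s L< ⟩
  suc (ℓ * suc i + i)     ≡⟨ expand ℓ i ⟩
  suc i * suc ℓ           ≤⟨ *-monoˡ-≤ (suc ℓ) (∸-monoˡ-≤ 1 (≰⇒> c≰)) ⟩
  (c ∸ 1) * suc ℓ         ≤⟨ packed ⟩
  suc L                   ∎))
  where
  open ≤-Reasoning
  expand : ∀ ℓ i → suc (ℓ * suc i + i) ≡ suc i * suc ℓ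
  expand = solve-∀

corollary2p3 : ∀ {n : ℕ} (G : Graph n) → Connected G →
    (k : ℕ) → 3 ≤ k →
    (S : List (Fin n × Fin n)) → All (IsEdge G) S → Unique S → 2 ≤ length S →
    (ℓ L : ℕ) →
    (∃ λ e → ∃ λ f → e ∈ S × f ∈ S × ¬ e ≡ f × EdgeDist G e f ℓ) →
    (∀ e f d → e ∈ S → f ∈ S → ¬ e ≡ f → EdgeDist G e f d → ℓ ≤ d) →
    (∃ λ e → ∃ λ f → e ∈ S × f ∈ S × EdgeDist G e f L) →
    (∀ e f d → e ∈ S → f ∈ S → EdgeDist G e f d → d ≤ L) →
    L < ℓ * (k ∸ 1) + (k ∸ 2) →
    EdgeGeneralPosition G k S
corollary2p3 G _ k 3≤k S edges unique _ ℓ L _ ℓ-min _ L-max L< _ _ _ P geodesic =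
  packed-count-≤ k (<⇒≤ 3≤k) (countOn-bound ℓ-min L-max geodesic edges unique) L<
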